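{- Let $P$ be a finite poset and let $I\in\mathcal{IC}(P)$ be an interval-closed set containing all the maximal elements of $P$. Then $\mathrm{Row}(I)=P-I$.
   Context: A subset $I\subseteq P$ is interval-closed if whenever $x,y\in I$ and $x\le z\le y$, then $z\in I$; $\mathcal{IC}(P)$ is the set of interval-closed subsets. For $x\in P$, the toggle $t_x:\mathcal{IC}(P)\to\mathcal{IC}(P)$ sends $I$ to $I\triangle\{x\}$ if this set is interval-closed, and to $I$ otherwise. Rowmotion is $\mathrm{Row}=t_{x_1}\circ\cdots\circ t_{x_N}$ for a linear extension $(x_1,\dots,x_N)$ of $P$ (so $t_{x_N}$ is applied first; the result is independent of the choice of linear extension). -}

module Defs where

open import Level using (0ℓ)
open import Data.Nat using (ℕ)
open import Data.Bool using (not)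
open import Data.Fin using (Fin; _≤_)
open import Data.Fin.Subset using (Subset; _∈_)
open import Data.Fin.Subset.Properties using (_∈?_)
open import Data.Fin.Properties using (all?)
open import Data.List using (List; []; _∷_; map)
open import Data.Product using (_×_)
open import Data.Vec using (_[_]%=_)
open import Relation.Binary using (Rel; IsDecPartialOrder)
open import Relation.Binary.PropositionalEquality using (_≡_)
open import Relation.Nullary using (Dec; yes; no; _→-dec_)

record FinPoset : Set₁ where
  field
    size          : ℕ
    _≼_           : Rel (Fin size) 0ℓ
    isDecPartialOrder : IsDecPartialOrder _≡_ _≼_
  open IsDecPartialOrder isDecPartialOrder public using () renaming (_≤?_ to _≼?_)

module _ (P : FinPoset) where
  open FinPoset P

  IsIntervalClosed : Subset size → Set
  IsIntervalClosed I = ∀ x y z → x ∈ I → y ∈ I → x ≼ z → z ≼ y → z ∈ I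

  isIntervalClosed? : (I : Subset size) → Dec (IsIntervalClosed I)
  isIntervalClosed? I =
    all? λ x → all? λ y → all? λ z →
      (x ∈? I) →-dec (y ∈? I) →-dec (x ≼? z) →-dec (z ≼? y) →-dec (z ∈? I)

  IsMaximal : Fin size → Set
  IsMaximal x = ∀ y → x ≼ y → y ≡ x

  flipAt : Fin size → Subset size → Subset size
  flipAt x I = I [ x ]%= not

  toggle : Fin size → Subset size → Subset size
  toggle x I with isIntervalClosed? (flipAt x I)
  ... | yes _ = flipAt x I
  ... | no  _ = I

  -- A linear extension (x_1, …, x_N), given as σ : position ↦ element:
  -- σ is injective (hence a bijection Fin N → Fin N) and order-compatible,
  -- i.e. x_i ≤_P x_j implies i ≤ j.
  record LinearExtension : Set where
    field
      σ         : Fin size → Fin size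
      injective : ∀ i j → σ i ≡ σ j → i ≡ j
      monotone  : ∀ i j → σ i ≼ σ j → i ≤ j

  -- apply toggles in the list, last one first: t_{a₁} ∘ … ∘ t_{aₖ}
  toggles : List (Fin size) → Subset size → Subset size
  toggles []       I = I
  toggles (a ∷ as) I = toggle a (toggles as I)

  Row : LinearExtension → Subset size → Subset size
  Row L = toggles (map σ (Data.List.allFin size))
    where open LinearExtension L

-- Toggling along a linear extension visits the elements from the top down,
-- so the toggles already performed always form an up-set U, and the current
-- set is I △ U.  Such a set is again interval-closed: for x ≤ z ≤ y in I △ U
-- with y ∈ U, either z ∈ U and z ∉ I (otherwise z ≤ y ≤ m for a maximal
-- m ∈ I would force y ∈ I), or z ∉ U, x ∉ U, and z ∈ I by x ≤ z ≤ m.  Hence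
-- every toggle succeeds, and once U = P the result is I △ P = P − I.
module Submission where

open import Defs
open import Data.Fin.Subset using (Subset; _∈_; ∁)
open import Relation.Binary.PropositionalEquality using (_≡_)

open import Data.Bool using (not)
open import Data.Fin using (Fin; punchOut; _≟_)
open import Data.Fin.Induction using (po-noetherian)
open import Data.Fin.Properties using (any?; injective⇒≤; punchOut-injective)
open import Data.Fin.Subset.Properties using (⊆-antisym; x∈∁p⇒x∉p; x∉p⇒x∈∁p)
open import Data.List using (List; []; _∷_; map; allFin)
open import Data.List.Membership.Propositional using () renaming (_∈_ to _∈ₗ_; _∉_ to _∉ₗ_)
open import Data.List.Membership.Propositional.Properties using (∈-map⁺; ∈-allFin)
import Data.List.Relation.Unary.All as All
open import Data.List.Relation.Unary.All.Properties using (All¬⇒¬Any)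
open import Data.List.Relation.Unary.AllPairs using (AllPairs; []; _∷_)
import Data.List.Relation.Unary.AllPairs as AllPairs
open import Data.List.Relation.Unary.AllPairs.Properties using (map⁺; tabulate⁺-<)
open import Data.List.Relation.Unary.Any using (here; there)
open import Data.List.Relation.Unary.Unique.Propositional using (Unique)
open import Data.Nat using (ℕ; suc)
open import Data.Nat.Properties using (<-irrefl; <⇒≱)
open import Data.Product using (∃; _,_; _×_)
open import Data.Vec using (lookup; _[_]%=_)
open import Data.Vec.Properties using ([]=⇒lookup; lookup⇒[]=; lookup∘updateAt; lookup∘updateAt′; lookup-map)
open import Function using (_∘_; flip)
open import Function.Definitions using (Injective)
open import Induction.WellFounded using (Acc; acc)
open import Relation.Binary using (IsDecPartialOrder)
import Relation.Binary.Construct.NonStrictToStrict as ToStrict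
open import Relation.Binary.PropositionalEquality using (refl; sym; trans; cong; subst; ≢-sym; module ≡-Reasoning)
open import Relation.Nullary using (¬_; yes; no; contradiction; _×-dec_; ¬?)
open import Relation.Nullary.Decidable using (decidable-stable)

injective⇒surjective : ∀ {n} {f : Fin n → Fin n} → Injective _≡_ _≡_ f → ∀ z → ∃ λ i → f i ≡ z
injective⇒surjective {suc n} {f} f-inj z with any? (λ i → f i ≟ z)
... | yes hit = hit
... | no miss = contradiction (injective⇒≤ f-punched-inj) (<-irrefl refl)
  where
  f-punched : Fin (suc n) → Fin n
  f-punched i = punchOut {i = z} (λ z≡fi → miss (i , sym z≡fi))
  f-punched-inj : Injective _≡_ _≡_ f-punched
  f-punched-inj = f-inj ∘ punchOut-injective {i = z} _ _

module _ {n : ℕ} where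

  flipAll : List (Fin n) → Subset n → Subset n
  flipAll []       p = p
  flipAll (a ∷ as) p = flipAll as p [ a ]%= not

  ∈-resp-lookup : ∀ {p q : Subset n} {z} → lookup p z ≡ lookup q z → z ∈ p → z ∈ q
  ∈-resp-lookup {q = q} {z} eq z∈p = lookup⇒[]= z q (trans (sym eq) ([]=⇒lookup z∈p))

  lookup-flipAll-∉ : ∀ p {ℓ z} → z ∉ₗ ℓ → lookup (flipAll ℓ p) z ≡ lookup p z
  lookup-flipAll-∉ p {[]}     _   = refl
  lookup-flipAll-∉ p {a ∷ as} z∉ℓ =
    trans (lookup∘updateAt′ _ a (z∉ℓ ∘ here) (flipAll as p)) (lookup-flipAll-∉ p (z∉ℓ ∘ there))

  lookup-flipAll-∈ : ∀ p {ℓ z} → Unique ℓ → z ∈ₗ ℓ → lookup (flipAll ℓ p) z ≡ lookup (∁ p) z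
  lookup-flipAll-∈ p {a ∷ as} {z} (a∉as ∷ _) (here refl) = begin
    lookup (flipAll (a ∷ as) p) z  ≡⟨ lookup∘updateAt z (flipAll as p) ⟩
    not (lookup (flipAll as p) z)  ≡⟨ cong not (lookup-flipAll-∉ p (All¬⇒¬Any a∉as)) ⟩
    not (lookup p z)               ≡⟨ lookup-map z not p ⟨
    lookup (∁ p) z                 ∎
    where open ≡-Reasoning
  lookup-flipAll-∈ p {a ∷ as} {z} (a∉as ∷ as!) (there z∈as) with z ≟ a
  ... | yes refl = contradiction z∈as (All¬⇒¬Any a∉as)
  ... | no  z≢a  = trans (lookup∘updateAt′ z a z≢a (flipAll as p)) (lookup-flipAll-∈ p as! z∈as)

  flipAll-∉ : ∀ {p ℓ z} → z ∉ₗ ℓ → z ∈ flipAll ℓ p → z ∈ p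
  flipAll-∉ {p} z∉ℓ = ∈-resp-lookup (lookup-flipAll-∉ p z∉ℓ)

  ∉-flipAll : ∀ {p ℓ z} → z ∉ₗ ℓ → z ∈ p → z ∈ flipAll ℓ p
  ∉-flipAll {p} z∉ℓ = ∈-resp-lookup (sym (lookup-flipAll-∉ p z∉ℓ))

  flipAll-∈ : ∀ {p ℓ z} → Unique ℓ → z ∈ₗ ℓ → z ∈ flipAll ℓ p → z ∈ ∁ p
  flipAll-∈ {p} ℓ! z∈ℓ = ∈-resp-lookup (lookup-flipAll-∈ p ℓ! z∈ℓ)

  ∈-flipAll : ∀ {p ℓ z} → Unique ℓ → z ∈ₗ ℓ → z ∈ ∁ p → z ∈ flipAll ℓ p
  ∈-flipAll {p} ℓ! z∈ℓ = ∈-resp-lookup (sym (lookup-flipAll-∈ p ℓ! z∈ℓ))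

  flipAll-complete : ∀ p {ℓ} → Unique ℓ → (∀ z → z ∈ₗ ℓ) → flipAll ℓ p ≡ ∁ p
  flipAll-complete p ℓ! total =
    ⊆-antisym (flipAll-∈ ℓ! (total _)) (∈-flipAll ℓ! (total _))

module _ (P : FinPoset) where
  open FinPoset P
  open import Data.List.Membership.DecPropositional (_≟_ {size}) using () renaming (_∈?_ to _∈ₗ?_)
  open IsDecPartialOrder isDecPartialOrder using (isPartialOrder; reflexive) renaming (refl to ≼-refl; trans to ≼-trans)

  UpClosed : List (Fin size) → Set
  UpClosed ℓ = ∀ {a w} → a ∈ₗ ℓ → a ≼ w → w ∈ₗ ℓ

  Cofinal : Subset size → Set
  Cofinal I = ∀ y → ∃ λ m → y ≼ m × m ∈ I

  Ascending : List (Fin size) → Set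
  Ascending = AllPairs (λ a b → ¬ b ≼ a)

  maximal-above : ∀ y → ∃ λ m → y ≼ m × IsMaximal P m
  maximal-above y = go (po-noetherian isPartialOrder y)
    where
    go : ∀ {y} → Acc (flip (ToStrict._<_ _≡_ _≼_)) y → ∃ λ m → y ≼ m × IsMaximal P m
    go {y} (acc above) with any? (λ w → y ≼? w ×-dec ¬? (w ≟ y))
    ... | yes (w , y≼w , w≢y) =
      let m , w≼m , m-max = go (above (y≼w , ≢-sym w≢y)) in m , ≼-trans y≼w w≼m , m-max
    ... | no ∄w = y , ≼-refl , λ w y≼w → decidable-stable (w ≟ y) (λ w≢y → ∄w (w , y≼w , w≢y))

  Ascending⇒Unique : ∀ {ℓ} → Ascending ℓ → Unique ℓ
  Ascending⇒Unique = AllPairs.map (λ b⋠a a≡b → b⋠a (reflexive (sym a≡b)))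

  UpClosed-tail : ∀ {a as} → Ascending (a ∷ as) → UpClosed (a ∷ as) → UpClosed as
  UpClosed-tail (a⋠as ∷ _) up b∈as b≼w with up (there b∈as) b≼w
  ... | here refl  = contradiction b≼w (All.lookup a⋠as b∈as)
  ... | there w∈as = w∈as

  flipAll-isIntervalClosed : ∀ {I ℓ} → IsIntervalClosed P I → Cofinal I → Unique ℓ → UpClosed ℓ →
                             IsIntervalClosed P (flipAll ℓ I)
  flipAll-isIntervalClosed {ℓ = ℓ} ic cof ℓ! up x y z x∈J y∈J x≼z z≼y
    with cof y | y ∈ₗ? ℓ | z ∈ₗ? ℓ
  ... | _ | no y∉ℓ | _ =
    ∉-flipAll z∉ℓ (ic x y z (flipAll-∉ x∉ℓ x∈J) (flipAll-∉ y∉ℓ y∈J) x≼z z≼y)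
    where
    x∉ℓ = y∉ℓ ∘ flip up (≼-trans x≼z z≼y)
    z∉ℓ = y∉ℓ ∘ flip up z≼y
  ... | m , y≼m , m∈I | yes y∈ℓ | yes z∈ℓ =
    ∈-flipAll ℓ! z∈ℓ (x∉p⇒x∈∁p λ z∈I → x∈∁p⇒x∉p (flipAll-∈ ℓ! y∈ℓ y∈J) (ic z m y z∈I m∈I z≼y y≼m))
  ... | m , y≼m , m∈I | yes _ | no z∉ℓ =
    ∉-flipAll z∉ℓ (ic x m z (flipAll-∉ (z∉ℓ ∘ flip up x≼z) x∈J) m∈I x≼z (≼-trans z≼y y≼m))

  toggle-succeeds : ∀ {a J} → IsIntervalClosed P (flipAt P a J) → toggle P a J ≡ flipAt P a J
  toggle-succeeds {a} {J} ic with isIntervalClosed? P (flipAt P a J)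
  ... | yes _  = refl
  ... | no ¬ic = contradiction ic ¬ic

  toggles≡flipAll : ∀ {I ℓ} → IsIntervalClosed P I → Cofinal I → Ascending ℓ → UpClosed ℓ →
                    toggles P ℓ I ≡ flipAll ℓ I
  toggles≡flipAll             ic cof []           _  = refl
  toggles≡flipAll {I} {a ∷ as} ic cof asc@(_ ∷ as↑) up = begin
    toggle P a (toggles P as I)  ≡⟨ cong (toggle P a) (toggles≡flipAll ic cof as↑ (UpClosed-tail asc up)) ⟩
    toggle P a (flipAll as I)    ≡⟨ toggle-succeeds (flipAll-isIntervalClosed ic cof (Ascending⇒Unique asc) up) ⟩
    flipAll (a ∷ as) I           ∎
    where open ≡-Reasoning

  module _ (L : LinearExtension P) where
    open LinearExtension L

    elements : List (Fin size)
    elements = map σ (allFin size)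

    ∈-elements : ∀ z → z ∈ₗ elements
    ∈-elements z with i , σi≡z ← injective⇒surjective (injective _ _) z =
      subst (_∈ₗ elements) σi≡z (∈-map⁺ σ (∈-allFin i))

    elements-ascending : Ascending elements
    elements-ascending = map⁺ (tabulate⁺-< λ {i} {j} i<j σj≼σi → <⇒≱ i<j (monotone j i σj≼σi))

lemma2p10 : (P : FinPoset) (L : LinearExtension P) (I : Subset (FinPoset.size P))
    → IsIntervalClosed P I
    → (∀ x → IsMaximal P x → x ∈ I)
    → Row P L I ≡ ∁ I
lemma2p10 P L I ic max∈I = begin
  Row P L I                   ≡⟨ toggles≡flipAll P ic cofinal (elements-ascending P L) (λ _ _ → ∈-elements P L _) ⟩
  flipAll (elements P L) I    ≡⟨ flipAll-complete I (Ascending⇒Unique P (elements-ascending P L)) (∈-elements P L) ⟩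
  ∁ I                         ∎
  where
  open ≡-Reasoning
  cofinal : Cofinal P I
  cofinal y = let m , y≼m , m-max = maximal-above P y in m , y≼m , max∈I m m-max
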